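{- Let $m$ be a positive integer and $n\ge 3$ an integer. For every feasible labeled column vector $X\in T(m)$, the set ${\cal F}_n(X)$ is nonempty; that is, there is a function $f\in{\cal F}_n$ such that, for each $k=1,\dots,m$, the label of the vertex $v_{k,n}$ (in the last column of $G_{m,n}$) with respect to $f$ is the $k$-th entry $X(k)$ of $X$.
   Context: The grid graph $G_{m,n}$ has vertex set $V_{m,n}=\{v_{i,j}: 1\le i\le m,\ 1\le j\le n\}$, where $v_{i_1,j_1}v_{i_2,j_2}$ is an edge iff ($|i_1-i_2|=1$ and $j_1=j_2$) or ($i_1=i_2$ and $|j_1-j_2|=1$); the $j$-th column is $\{v_{1,j},\dots,v_{m,j}\}$. $N(v)$ is the set of neighbors of $v$, $N[v]=N(v)\cup\{v\}$, and $f(S)=\sum_{v\in S}f(v)$. Labels: given $f:V_{m,n}\to\{0,1,2\}$, each vertex $v$ receives the label $\alpha_2$ if $f(v)=2$; $\alpha_{11}$ if $f(v)=1$ and $f(N(v))\ge1$; $\alpha_{10}$ if $f(v)=1$ and $f(N(v))=0$; $\alpha_{02}$ if $f(v)=0$ and $f(N(v))\ge 2$; $\alpha_{01}$ if $f(v)=0$ and $f(N(v))=1$; $\alpha_{00}$ if $f(v)=0$ and $f(N(v))=0$. Feasible vectors: a column vector $X=(X(1),\dots,X(m))^T$ with entries in $\{\alpha_2,\alpha_{11},\alpha_{10},\alpha_{02},\alpha_{01},\alpha_{00}\}$ is feasible if no two consecutive entries $(X(k),X(k+1))$ equal any of the ordered pairs $(\alpha_2,\alpha_{10})$, $(\alpha_2,\alpha_{01})$,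 $(\alpha_2,\alpha_{00})$, $(\alpha_{11},\alpha_{10})$, $(\alpha_{11},\alpha_{00})$, $(\alpha_{10},\alpha_2)$, $(\alpha_{10},\alpha_{11})$, $(\alpha_{10},\alpha_{10})$, $(\alpha_{10},\alpha_{00})$, $(\alpha_{01},\alpha_2)$, $(\alpha_{00},\alpha_2)$, $(\alpha_{00},\alpha_{11})$, $(\alpha_{00},\alpha_{10})$, and no three consecutive entries $(X(k),X(k+1),X(k+2))$ equal any of $(\alpha_{11},\alpha_{01},\alpha_{11})$, $(\alpha_{11},\alpha_{01},\alpha_{10})$, $(\alpha_{10},\alpha_{01},\alpha_{11})$, $(\alpha_{10},\alpha_{01},\alpha_{10})$. $T(m)$ is the set of feasible column vectors of length $m$. ${\cal F}_n$ (for fixed $m$) is the set of functions $f:V_{m,n}\to\{0,1,2\}$ such that $\sum_{u\in N[v]}f(u)\ge 2$ for every vertex $v$ not in the last column (column $n$) of $G_{m,n}$. For $X\in T(m)$, ${\cal F}_n(X)$ is the set of $f\in{\cal F}_n$ for which the labels of the last column $v_{1,n},\dots,v_{m,n}$ with respect to $f$ are $X(1),\dots,X(m)$. -}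

module Defs where

open import Data.Nat using (ℕ; zero; suc; _+_; _≤_; _<_; _≥_)
open import Data.Fin using (Fin; toℕ; fromℕ<)
open import Data.Nat.Properties using (≤-refl)
open import Data.Vec using (Vec; []; _∷_; lookup)
open import Data.List using (List; []; _∷_; map; allFin)
open import Data.Nat.ListAction using (sum)
open import Data.Product using (_×_; _,_)
open import Relation.Binary.PropositionalEquality using (_≡_; _≢_)
open import Relation.Nullary using (¬_)
open import Data.Empty using (⊥)
open import Data.Unit using (⊤)

data Val : Set where
  z0 z1 z2 : Val

val : Val → ℕ
val z0 = 0
val z1 = 1
val z2 = 2

-- A function f : V_{m,n} → {0,1,2}.  Vertex v_{i,j} (1 ≤ i ≤ m, 1 ≤ j ≤ n)
-- is represented by (i , j) : Fin m × Fin n, 0-based (v_{i,j} ↦ (i-1 , j-1)).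
GridFun : ℕ → ℕ → Set
GridFun m n = Fin m → Fin n → Val

adj1? : (a b : ℕ) → ℕ
adj1? zero zero = 0
adj1? zero (suc zero) = 1
adj1? zero (suc (suc _)) = 0
adj1? (suc zero) zero = 1
adj1? (suc (suc _)) zero = 0
adj1? (suc a) (suc b) = adj1? a b

eq? : ℕ → ℕ → ℕ
eq? zero zero = 1
eq? zero (suc _) = 0
eq? (suc _) zero = 0
eq? (suc a) (suc b) = eq? a b

adjInd : ∀ {m n} → (Fin m × Fin n) → (Fin m × Fin n) → ℕ
adjInd (i₁ , j₁) (i₂ , j₂) =
  adj1? (toℕ i₁) (toℕ i₂) Data.Nat.* eq? (toℕ j₁) (toℕ j₂)
  + eq? (toℕ i₁) (toℕ i₂) Data.Nat.* adj1? (toℕ j₁) (toℕ j₂)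

fN : ∀ {m n} → GridFun m n → Fin m → Fin n → ℕ
fN {m} {n} f i j =
  sum (map (λ i' → sum (map (λ j' → adjInd (i' , j') (i , j) Data.Nat.* val (f i' j'))
                             (allFin n)))
           (allFin m))

fNc : ∀ {m n} → GridFun m n → Fin m → Fin n → ℕ
fNc f i j = val (f i j) + fN f i j

data Label : Set where
  α2 α11 α10 α02 α01 α00 : Label

labelOf : ∀ {m n} → GridFun m n → Fin m → Fin n → Label
labelOf f i j with f i j | fN f i j
... | z2 | _ = α2
... | z1 | zero = α10
... | z1 | suc _ = α11
... | z0 | zero = α00
... | z0 | suc zero = α01
... | z0 | suc (suc _) = α02

ForbiddenPair : Label → Label → Set
ForbiddenPair α2  α10 = ⊤
ForbiddenPair α2  α01 = ⊤
ForbiddenPair α2  α00 = ⊤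
ForbiddenPair α11 α10 = ⊤
ForbiddenPair α11 α00 = ⊤
ForbiddenPair α10 α2  = ⊤
ForbiddenPair α10 α11 = ⊤
ForbiddenPair α10 α10 = ⊤
ForbiddenPair α10 α00 = ⊤
ForbiddenPair α01 α2  = ⊤
ForbiddenPair α00 α2  = ⊤
ForbiddenPair α00 α11 = ⊤
ForbiddenPair α00 α10 = ⊤
ForbiddenPair _   _   = ⊥

ForbiddenTriple : Label → Label → Label → Set
ForbiddenTriple α11 α01 α11 = ⊤
ForbiddenTriple α11 α01 α10 = ⊤
ForbiddenTriple α10 α01 α11 = ⊤
ForbiddenTriple α10 α01 α10 = ⊤
ForbiddenTriple _   _   _   = ⊥

Feasible : ∀ {m} → Vec Label m → Set
Feasible [] = ⊤
Feasible (a ∷ []) = ⊤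
Feasible (a ∷ b ∷ []) = ¬ ForbiddenPair a b
Feasible (a ∷ b ∷ c ∷ xs) =
  ¬ ForbiddenPair a b × ¬ ForbiddenTriple a b c × Feasible (b ∷ c ∷ xs)

-- v_{i,j} is not in the last column (column n), i.e. j ≠ n (0-based: toℕ j + 1 < n)
NotLastCol : ∀ {n} → Fin n → Set
NotLastCol {n} j = suc (toℕ j) < n

InF : ∀ {m n} → GridFun m n → Set
InF {m} {n} f = ∀ (i : Fin m) (j : Fin n) → NotLastCol j → fNc f i j ≥ 2

lastCol : (n : ℕ) → n ≥ 1 → Fin n
lastCol (suc k) _ = fromℕ< ≤-refl

{-# OPTIONS --safe #-}
module Submission where

-- Put 2 on every column but the last two, on v_{k,n} the value encoded by X(k) (2 for α2, 1 for
-- α11 and α10, 0 otherwise), and on v_{k,n-1} the value 2 if X(k) is α2, α11 or α02, 0 if it is α10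
-- or α00, and 1 minus the total value of the two vertical neighbours of v_{k,n} if it is α01.
-- Then v_{k,n} gets the label X(k) as soon as those vertical neighbours have value 0 when X(k) is
-- α10 or α00 and total value at most 1 when X(k) is α01, which is exactly what feasibility of X
-- guarantees. Every vertex outside the last column has value 2 or, in column n-1, a left neighbour
-- of value 2.

open import Defs
open import Data.Nat using (ℕ; zero; suc; _+_; _*_; _∸_; _≥_; _≤_; _<_; s≤s; z≤n)
open import Data.Nat.Properties
  using (module ≤-Reasoning; ≤-trans; ≤-refl; +-assoc; +-comm; +-identityʳ; *-assoc; *-distribʳ-+; +-*-semiring;
         m≤m+n; m≤n+m; m≤n⇒m<n∨m≡n; m≤n⇒m∸n≡0; m+n∸n≡m; n∸n≡0)
open import Algebra.Properties.Semiring.Sum +-*-semiring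
  using (sum-syntax; sum-cong-≗; ∑-distrib-+; *-distribˡ-sum; sum-replicate-zero)
import Data.Nat.ListAction as ListAction
open import Data.List using (map; allFin; tabulate)
open import Data.List.Properties using (map-tabulate)
open import Data.Fin using (Fin; zero; suc; toℕ; fromℕ<)
open import Data.Fin.Properties using (toℕ-fromℕ<; toℕ<n)
open import Data.Vec using (Vec; []; _∷_; lookup)
open import Data.Maybe using (Maybe; just; nothing)
open import Data.Product using (Σ; _×_; _,_)
open import Data.Sum using (_⊎_; inj₁; inj₂)
open import Data.Unit using (⊤; tt)
open import Data.Empty using (⊥; ⊥-elim)
open import Relation.Nullary using (¬_)
open import Relation.Binary.PropositionalEquality using (_≡_; refl; sym; trans; cong; cong₂; module ≡-Reasoning)

sum-tabulate : ∀ n (g : Fin n → ℕ) → ListAction.sum (tabulate g) ≡ ∑[ i < n ] g i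
sum-tabulate zero    g = refl
sum-tabulate (suc n) g = cong (g zero +_) (sum-tabulate n (λ i → g (suc i)))

sum-map-allFin : ∀ n (g : Fin n → ℕ) → ListAction.sum (map g (allFin n)) ≡ ∑[ i < n ] g i
sum-map-allFin n g = trans (cong ListAction.sum (map-tabulate (λ i → i) g)) (sum-tabulate n g)

1*x+∑0≡x : ∀ n x → 1 * x + ∑[ i < n ] 0 ≡ x
1*x+∑0≡x n x = begin
  (x + 0) + ∑[ i < n ] 0 ≡⟨ cong (x + 0 +_) (sum-replicate-zero n) ⟩
  (x + 0) + 0            ≡⟨ trans (+-identityʳ _) (+-identityʳ _) ⟩
  x                      ∎
  where open ≡-Reasoning

∑-eq? : ∀ {n} (j : Fin n) (g : Fin n → ℕ) → ∑[ i < n ] (eq? (toℕ i) (toℕ j) * g i) ≡ g j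
∑-eq? {suc n} zero g = 1*x+∑0≡x n (g zero)
∑-eq? (suc j) g = ∑-eq? j (λ i → g (suc i))

previous : ∀ {A : Set} → A → (ℕ → A) → ℕ → A
previous d h zero    = d
previous d h (suc i) = h i

previous-map : ∀ {A B : Set} (g : A → B) d (h : ℕ → A) i →
               g (previous d h i) ≡ previous (g d) (λ k → g (h k)) i
previous-map g d h zero    = refl
previous-map g d h (suc i) = refl

adj1?-suc : ∀ a b → adj1? (suc a) (suc b) ≡ adj1? a b
adj1?-suc zero    b = refl
adj1?-suc (suc a) b = refl

∑-adj1?-suc : ∀ n i (h : ℕ → ℕ) →
  ∑[ a < n ] (adj1? (suc (toℕ a)) (suc i) * h (suc (toℕ a))) ≡ ∑[ a < n ] (adj1? (toℕ a) i * h (suc (toℕ a)))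
∑-adj1?-suc n i h = sum-cong-≗ {n} (λ a → cong (_* h (suc (toℕ a))) (adj1?-suc (toℕ a) i))

adj1?-0+previous : ∀ i (h : ℕ → ℕ) → adj1? 0 (suc i) * h 0 + previous 0 (λ k → h (suc k)) i ≡ h i
adj1?-0+previous zero    h = trans (+-identityʳ _) (+-identityʳ _)
adj1?-0+previous (suc i) h = refl

∑-adj1?-last : ∀ i (h : ℕ → ℕ) → ∑[ a < suc i ] (adj1? (toℕ a) i * h (toℕ a)) ≡ previous 0 h i
∑-adj1?-last zero    h = refl
∑-adj1?-last (suc i) h = begin
  adj1? 0 (suc i) * h 0 + ∑[ a < suc i ] (adj1? (suc (toℕ a)) (suc i) * h (suc (toℕ a)))
    ≡⟨ cong (adj1? 0 (suc i) * h 0 +_) (trans (∑-adj1?-suc (suc i) i h) (∑-adj1?-last i (λ k → h (suc k)))) ⟩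
  adj1? 0 (suc i) * h 0 + previous 0 (λ k → h (suc k)) i
    ≡⟨ adj1?-0+previous i h ⟩
  previous 0 h (suc i) ∎
  where open ≡-Reasoning

∑-adj1?-inner : ∀ {n} i (h : ℕ → ℕ) → suc i < n →
  ∑[ a < n ] (adj1? (toℕ a) i * h (toℕ a)) ≡ previous 0 h i + h (suc i)
∑-adj1?-inner {suc (suc n)} zero h _ = 1*x+∑0≡x n (h 1)
∑-adj1?-inner {suc n} (suc i) h (s≤s i<n) = begin
  adj1? 0 (suc i) * h 0 + ∑[ a < n ] (adj1? (suc (toℕ a)) (suc i) * h (suc (toℕ a)))
    ≡⟨ cong (adj1? 0 (suc i) * h 0 +_) (trans (∑-adj1?-suc n i h) (∑-adj1?-inner i (λ k → h (suc k)) i<n)) ⟩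
  adj1? 0 (suc i) * h 0 + (previous 0 (λ k → h (suc k)) i + h (suc (suc i)))
    ≡⟨ sym (+-assoc (adj1? 0 (suc i) * h 0) _ _) ⟩
  (adj1? 0 (suc i) * h 0 + previous 0 (λ k → h (suc k)) i) + h (suc (suc i))
    ≡⟨ cong (_+ h (suc (suc i))) (adj1?-0+previous i h) ⟩
  previous 0 h (suc i) + h (suc (suc i)) ∎
  where open ≡-Reasoning

∑-adj1? : ∀ {n} i (h : ℕ → ℕ) → i < n → h n ≡ 0 →
  ∑[ a < n ] (adj1? (toℕ a) i * h (toℕ a)) ≡ previous 0 h i + h (suc i)
∑-adj1? i h i<n hn≡0 with m≤n⇒m<n∨m≡n i<n
... | inj₁ 1+i<n = ∑-adj1?-inner i h 1+i<n
... | inj₂ refl  = begin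
  ∑[ a < suc i ] (adj1? (toℕ a) i * h (toℕ a)) ≡⟨ ∑-adj1?-last i h ⟩
  previous 0 h i                               ≡⟨ sym (+-identityʳ _) ⟩
  previous 0 h i + 0                           ≡⟨ cong (previous 0 h i +_) (sym hn≡0) ⟩
  previous 0 h i + h (suc i)                   ∎
  where open ≡-Reasoning

fN≡row+column : ∀ {m n} (f : GridFun m n) (i : Fin m) (j : Fin n) →
  fN f i j ≡ ∑[ b < n ] (adj1? (toℕ b) (toℕ j) * val (f i b)) + ∑[ a < m ] (adj1? (toℕ a) (toℕ i) * val (f a j))
fN≡row+column {m} {n} f i j = begin
  fN f i j
    ≡⟨ trans (sum-map-allFin m _) (sum-cong-≗ {m} (λ a → sum-map-allFin n _)) ⟩
  ∑[ a < m ] ∑[ b < n ] ((adj1? (toℕ a) I * eq? (toℕ b) J + eq? (toℕ a) I * adj1? (toℕ b) J) * val (f a b))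
    ≡⟨ sum-cong-≗ {m} split ⟩
  ∑[ a < m ] (adj1? (toℕ a) I * val (f a j) + eq? (toℕ a) I * row a)
    ≡⟨ ∑-distrib-+ {m} _ _ ⟩
  column + ∑[ a < m ] (eq? (toℕ a) I * row a)
    ≡⟨ cong (column +_) (∑-eq? i row) ⟩
  column + row i
    ≡⟨ +-comm column (row i) ⟩
  row i + column ∎
  where
  open ≡-Reasoning
  I = toℕ i
  J = toℕ j
  row : Fin m → ℕ
  row a = ∑[ b < n ] (adj1? (toℕ b) J * val (f a b))
  column : ℕ
  column = ∑[ a < m ] (adj1? (toℕ a) I * val (f a j))
  split : ∀ a → ∑[ b < n ] ((adj1? (toℕ a) I * eq? (toℕ b) J + eq? (toℕ a) I * adj1? (toℕ b) J) * val (f a b))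
                ≡ adj1? (toℕ a) I * val (f a j) + eq? (toℕ a) I * row a
  split a = begin
    ∑[ b < n ] ((x * eq? (toℕ b) J + e * adj1? (toℕ b) J) * val (f a b))
      ≡⟨ sum-cong-≗ {n} (λ b → trans (*-distribʳ-+ (val (f a b)) (x * eq? (toℕ b) J) _)
                                      (cong₂ _+_ (*-assoc x _ _) (*-assoc e _ _))) ⟩
    ∑[ b < n ] (x * (eq? (toℕ b) J * val (f a b)) + e * (adj1? (toℕ b) J * val (f a b)))
      ≡⟨ ∑-distrib-+ {n} _ _ ⟩
    ∑[ b < n ] (x * (eq? (toℕ b) J * val (f a b))) + ∑[ b < n ] (e * (adj1? (toℕ b) J * val (f a b)))
      ≡⟨ sym (cong₂ _+_ (*-distribˡ-sum x (λ b → eq? (toℕ b) J * val (f a b))) (*-distribˡ-sum e (λ b → adj1? (toℕ b) J * val (f a b)))) ⟩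
    x * ∑[ b < n ] (eq? (toℕ b) J * val (f a b)) + e * row a
      ≡⟨ cong (λ s → x * s + e * row a) (∑-eq? j (λ b → val (f a b))) ⟩
    x * val (f a j) + e * row a ∎
    where
    x = adj1? (toℕ a) I
    e = eq? (toℕ a) I

labelFor : Val → ℕ → Label
labelFor z2 _             = α2
labelFor z1 zero          = α10
labelFor z1 (suc _)       = α11
labelFor z0 zero          = α00
labelFor z0 (suc zero)    = α01
labelFor z0 (suc (suc _)) = α02

labelOf≡labelFor : ∀ {m n} (f : GridFun m n) i j → labelOf f i j ≡ labelFor (f i j) (fN f i j)
labelOf≡labelFor f i j with f i j | fN f i j
... | z2 | _            = refl
... | z1 | zero         = refl
... | z1 | suc _        = refl
... | z0 | zero         = refl
... | z0 | suc zero     = refl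
... | z0 | suc (suc _)  = refl

value : Label → Val
value α2  = z2
value α11 = z1
value α10 = z1
value α02 = z0
value α01 = z0
value α00 = z0

weight : Label → ℕ
weight x = val (value x)

weight? : Maybe Label → ℕ
weight? nothing  = 0
weight? (just x) = weight x

Admissible : Label → ℕ → Set
Admissible α10 v = v ≡ 0
Admissible α00 v = v ≡ 0
Admissible α01 v = v ≡ 0 ⊎ v ≡ 1
Admissible _   _ = ⊤

-- The value to put left of a last-column vertex labelled x whose vertical neighbours have total weight v.
companion : Label → ℕ → Val
companion α10 _       = z0
companion α00 _       = z0
companion α01 zero    = z1
companion α01 (suc _) = z0
companion _   _       = z2

labelFor-companion : ∀ x v → Admissible x v → labelFor (value x) (val (companion x v) + v) ≡ x
labelFor-companion α2  v _ = refl
labelFor-companion α11 v _ = refl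
labelFor-companion α02 v _ = refl
labelFor-companion α10 .0 refl = refl
labelFor-companion α00 .0 refl = refl
labelFor-companion α01 .0 (inj₁ refl) = refl
labelFor-companion α01 .1 (inj₂ refl) = refl

-- nothing stands for a neighbour outside the column; it takes part in no forbidden pattern.
ForbiddenPair? : Maybe Label → Maybe Label → Set
ForbiddenPair? (just x) (just y) = ForbiddenPair x y
ForbiddenPair? _        _        = ⊥

ForbiddenTriple? : Maybe Label → Label → Maybe Label → Set
ForbiddenTriple? (just b) x (just a) = ForbiddenTriple b x a
ForbiddenTriple? _        _ _        = ⊥

LocallyFeasible : Maybe Label → Label → Maybe Label → Set
LocallyFeasible b x a = ¬ ForbiddenPair? b (just x) × ¬ ForbiddenPair? (just x) a × ¬ ForbiddenTriple? b x a

data WeightView : Maybe Label → Set where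
  weightless : ∀ {b} → weight? b ≡ 0 → WeightView b
  is-α2      : WeightView (just α2)
  is-α11     : WeightView (just α11)
  is-α10     : WeightView (just α10)

weightView : ∀ b → WeightView b
weightView nothing    = weightless refl
weightView (just α2)  = is-α2
weightView (just α11) = is-α11
weightView (just α10) = is-α10
weightView (just α02) = weightless refl
weightView (just α01) = weightless refl
weightView (just α00) = weightless refl

admissible : ∀ b x a → LocallyFeasible b x a → Admissible x (weight? b + weight? a)
admissible _ α2  _ _ = tt
admissible _ α11 _ _ = tt
admissible _ α02 _ _ = tt
admissible b α10 a (bx , xa , _) with weightView b | weightView a
... | is-α2          | _              = ⊥-elim (bx tt)
... | is-α11         | _              = ⊥-elim (bx tt)
... | is-α10         | _              = ⊥-elim (bx tt)
... | weightless _   | is-α2          = ⊥-elim (xa tt)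
... | weightless _   | is-α11         = ⊥-elim (xa tt)
... | weightless _   | is-α10         = ⊥-elim (xa tt)
... | weightless b≡0 | weightless a≡0 = cong₂ _+_ b≡0 a≡0
admissible b α00 a (bx , xa , _) with weightView b | weightView a
... | is-α2          | _              = ⊥-elim (bx tt)
... | is-α11         | _              = ⊥-elim (bx tt)
... | is-α10         | _              = ⊥-elim (bx tt)
... | weightless _   | is-α2          = ⊥-elim (xa tt)
... | weightless _   | is-α11         = ⊥-elim (xa tt)
... | weightless _   | is-α10         = ⊥-elim (xa tt)
... | weightless b≡0 | weightless a≡0 = cong₂ _+_ b≡0 a≡0
admissible b α01 a (bx , xa , bxa) with weightView b | weightView a
... | is-α2          | _              = ⊥-elim (bx tt)
... | _              | is-α2          = ⊥-elim (xa tt)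
... | is-α11         | is-α11         = ⊥-elim (bxa tt)
... | is-α11         | is-α10         = ⊥-elim (bxa tt)
... | is-α10         | is-α11         = ⊥-elim (bxa tt)
... | is-α10         | is-α10         = ⊥-elim (bxa tt)
... | is-α11         | weightless a≡0 = inj₂ (cong suc a≡0)
... | is-α10         | weightless a≡0 = inj₂ (cong suc a≡0)
... | weightless b≡0 | is-α11         = inj₂ (cong (_+ 1) b≡0)
... | weightless b≡0 | is-α10         = inj₂ (cong (_+ 1) b≡0)
... | weightless b≡0 | weightless a≡0 = inj₁ (cong₂ _+_ b≡0 a≡0)

_‼_ : ∀ {A : Set} {m} → Vec A m → ℕ → Maybe A
[]       ‼ _     = nothing
(x ∷ xs) ‼ zero  = just x
(x ∷ xs) ‼ suc k = xs ‼ k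

‼-toℕ : ∀ {A : Set} {m} (X : Vec A m) (k : Fin m) → X ‼ toℕ k ≡ just (lookup X k)
‼-toℕ (x ∷ xs) zero    = refl
‼-toℕ (x ∷ xs) (suc k) = ‼-toℕ xs k

‼-length : ∀ {A : Set} {m} (X : Vec A m) → X ‼ m ≡ nothing
‼-length []       = refl
‼-length (x ∷ xs) = ‼-length xs

below : ∀ {A : Set} {m} → Vec A m → ℕ → Maybe A
below X = previous nothing (X ‼_)

feasible-head : ∀ {m} {x y} {xs : Vec Label m} → Feasible (x ∷ y ∷ xs) → ¬ ForbiddenPair x y
feasible-head {xs = []}    F = F
feasible-head {xs = _ ∷ _} (xy , _) = xy

feasible⇒locallyFeasible : ∀ {m} {X : Vec Label m} → Feasible X → (k : Fin m) →
  LocallyFeasible (below X (toℕ k)) (lookup X k) (X ‼ suc (toℕ k))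
feasible⇒locallyFeasible {X = x ∷ []}         _ zero = (λ ()) , (λ ()) , (λ ())
feasible⇒locallyFeasible {X = x ∷ y ∷ _}      F zero = (λ ()) , feasible-head F , (λ ())
feasible⇒locallyFeasible {X = x ∷ y ∷ []}     F (suc zero) = F , (λ ()) , (λ ())
feasible⇒locallyFeasible {X = x ∷ y ∷ z ∷ _}  (xy , xyz , F) (suc zero) = xy , feasible-head F , xyz
feasible⇒locallyFeasible {X = x ∷ y ∷ z ∷ _}  (_ , _ , F) (suc (suc k)) = feasible⇒locallyFeasible F (suc k)

stripe : Val → Val → ℕ → Val
stripe g c zero          = z2
stripe g c (suc zero)    = g
stripe g c (suc (suc _)) = c

module Construction {m} (X : Vec Label m) (p : ℕ) where

  neighbourWeight : ℕ → ℕ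
  neighbourWeight k = weight? (below X k) + weight? (X ‼ suc k)

  companionOf : Fin m → Val
  companionOf a = companion (lookup X a) (neighbourWeight (toℕ a))

  -- toℕ b ∸ p is 0 on the columns 0 … p, 1 on the companion column p + 1 and 2 on the last column.
  f : GridFun m (3 + p)
  f a b = stripe (companionOf a) (value (lookup X a)) (toℕ b ∸ p)

  last : Fin (3 + p)
  last = fromℕ< ≤-refl

  toℕ-last : toℕ last ≡ 2 + p
  toℕ-last = toℕ-fromℕ< (≤-refl {3 + p})

  f-last : ∀ a → f a last ≡ value (lookup X a)
  f-last a = cong (stripe (companionOf a) (value (lookup X a)))
                  (trans (cong (_∸ p) toℕ-last) (m+n∸n≡m 2 p))

  rowSum-last : ∀ k → ∑[ b < 3 + p ] (adj1? (toℕ b) (toℕ last) * val (f k b)) ≡ val (companionOf k)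
  rowSum-last k = begin
    ∑[ b < 3 + p ] (adj1? (toℕ b) (toℕ last) * val (f k b))
      ≡⟨ cong (λ J → ∑[ b < 3 + p ] (adj1? (toℕ b) J * val (f k b))) toℕ-last ⟩
    ∑[ b < 3 + p ] (adj1? (toℕ b) (2 + p) * val (f k b))
      ≡⟨ ∑-adj1?-last (2 + p) (λ j → val (stripe (companionOf k) (value (lookup X k)) (j ∸ p))) ⟩
    val (stripe (companionOf k) (value (lookup X k)) ((1 + p) ∸ p))
      ≡⟨ cong (λ d → val (stripe (companionOf k) (value (lookup X k)) d)) (m+n∸n≡m 1 p) ⟩
    val (companionOf k) ∎
    where open ≡-Reasoning

  columnSum-last : ∀ k → ∑[ a < m ] (adj1? (toℕ a) (toℕ k) * val (f a last)) ≡ neighbourWeight (toℕ k)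
  columnSum-last k = begin
    ∑[ a < m ] (adj1? (toℕ a) (toℕ k) * val (f a last))
      ≡⟨ sum-cong-≗ {m} (λ a → cong (adj1? (toℕ a) (toℕ k) *_)
                                     (trans (cong val (f-last a)) (cong weight? (sym (‼-toℕ X a))))) ⟩
    ∑[ a < m ] (adj1? (toℕ a) (toℕ k) * h (toℕ a))
      ≡⟨ ∑-adj1? (toℕ k) h (toℕ<n k) (cong weight? (‼-length X)) ⟩
    previous 0 h (toℕ k) + h (suc (toℕ k))
      ≡⟨ cong (_+ h (suc (toℕ k))) (sym (previous-map weight? nothing (X ‼_) (toℕ k))) ⟩
    neighbourWeight (toℕ k) ∎
    where
    open ≡-Reasoning
    h : ℕ → ℕ
    h i = weight? (X ‼ i)

  labelOf-last : Feasible X → ∀ k → labelOf f k last ≡ lookup X k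
  labelOf-last F k = begin
    labelOf f k last
      ≡⟨ labelOf≡labelFor f k last ⟩
    labelFor (f k last) (fN f k last)
      ≡⟨ cong₂ labelFor (f-last k)
               (trans (fN≡row+column f k last) (cong₂ _+_ (rowSum-last k) (columnSum-last k))) ⟩
    labelFor (value (lookup X k)) (val (companionOf k) + neighbourWeight (toℕ k))
      ≡⟨ labelFor-companion (lookup X k) _ (admissible (below X (toℕ k)) (lookup X k) (X ‼ suc (toℕ k)) (feasible⇒locallyFeasible F k)) ⟩
    lookup X k ∎
    where open ≡-Reasoning

  f-dominating : ∀ a b → toℕ b ≤ p → f a b ≡ z2
  f-dominating a b b≤p = cong (stripe (companionOf a) (value (lookup X a))) (m≤n⇒m∸n≡0 b≤p)

  rowSum-companionColumn : ∀ a → 2 ≤ ∑[ b < 3 + p ] (adj1? (toℕ b) (suc p) * val (f a b))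
  rowSum-companionColumn a = begin
    2                                         ≡⟨ cong (λ d → val (stripe (companionOf a) (value (lookup X a)) d)) (n∸n≡0 p) ⟨
    h p                                       ≤⟨ m≤m+n (h p) (h (2 + p)) ⟩
    h p + h (2 + p)                           ≡⟨ ∑-adj1?-inner (suc p) h ≤-refl ⟨
    ∑[ b < 3 + p ] (adj1? (toℕ b) (suc p) * val (f a b)) ∎
    where
    open ≤-Reasoning
    h : ℕ → ℕ
    h j = val (stripe (companionOf a) (value (lookup X a)) (j ∸ p))

  f∈𝓕 : InF f
  f∈𝓕 i j (s≤s (s≤s j≤1+p)) with m≤n⇒m<n∨m≡n j≤1+p
  ... | inj₁ (s≤s j≤p) = begin
    2                    ≡⟨ cong val (f-dominating i j j≤p) ⟨
    val (f i j)          ≤⟨ m≤m+n _ _ ⟩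
    val (f i j) + fN f i j ∎
    where open ≤-Reasoning
  ... | inj₂ j≡1+p = begin
    2                                                      ≤⟨ rowSum-companionColumn i ⟩
    ∑[ b < 3 + p ] (adj1? (toℕ b) (suc p) * val (f i b))   ≡⟨ cong (λ J → ∑[ b < 3 + p ] (adj1? (toℕ b) J * val (f i b))) j≡1+p ⟨
    ∑[ b < 3 + p ] (adj1? (toℕ b) (toℕ j) * val (f i b))   ≤⟨ m≤m+n _ _ ⟩
    ∑[ b < 3 + p ] (adj1? (toℕ b) (toℕ j) * val (f i b))
      + ∑[ a < m ] (adj1? (toℕ a) (toℕ i) * val (f a j))   ≡⟨ fN≡row+column f i j ⟨
    fN f i j                                               ≤⟨ m≤n+m _ _ ⟩
    val (f i j) + fN f i j ∎
    where open ≤-Reasoning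

proposition3p3 : (m n : ℕ) → (m≥1 : m ≥ 1) → (n≥3 : n ≥ 3) → (X : Vec Label m) → Feasible X →
    Σ (GridFun m n) (λ f → InF f × ((k : Fin m) → labelOf f k (lastCol n (≤-trans (s≤s z≤n) n≥3)) ≡ lookup X k))
proposition3p3 m (suc (suc (suc p))) _ (s≤s (s≤s (s≤s _))) X F =
  f , f∈𝓕 , labelOf-last F
  where open Construction X p
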